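{- Let $P$ be a set of $n\geq 2$ points in general position in $\mathbb{R}^2$. Then the edge disjointness graph $D(P)$ is not hamiltonian if at least one of the following holds: (C1) $n\in\{2,3,4,5\}$; (C2) $n=6$ and $P$ is in convex position.
   Context: A set of points is in general position if no three are collinear; it is in convex position if every point lies on the boundary of its convex hull (is a vertex of the convex hull). A segment of $P$ is a closed straight line segment whose two endpoints are distinct points of $P$. The edge disjointness graph $D(P)$ has as vertices all $\binom{n}{2}$ segments of $P$, two segments being adjacent iff they are disjoint. A graph is hamiltonian if it contains a cycle (with at least $3$ vertices) passing through every vertex. -}

module Defs where

open import Level using (0ℓ)
open import Data.Nat as ℕ using (ℕ; zero; suc)
open import Data.Nat.DivMod using (_%_; m%n<n)
open import Data.Fin as Fin using (Fin; toℕ; fromℕ<)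
open import Data.Product using (Σ; ∃; _×_; _,_; proj₁; proj₂)
open import Data.Sum using (_⊎_)
open import Relation.Binary.PropositionalEquality using (_≡_; _≢_)
open import Relation.Binary.Core using (Rel)
open import Relation.Binary.Structures using (IsStrictTotalOrder)
open import Relation.Nullary using (¬_)
open import Algebra.Core using (Op₁; Op₂)
open import Algebra.Structures using (IsCommutativeRing)
open import Function.Bundles using (_⤖_)

-- The real numbers, axiomatised as a complete ordered field
-- (any model is isomorphic to ℝ).  Equality is propositional.

record RealField : Set₁ where
  infixl 6 _+_
  infixl 7 _*_
  infix 4 _<_ _≤_
  field
    Carrier : Set
    _+_ _*_ : Op₂ Carrier
    -_      : Op₁ Carrier
    0# 1#   : Carrier
    isCommutativeRing : IsCommutativeRing _≡_ _+_ _*_ -_ 0# 1#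
    _<_     : Rel Carrier 0ℓ
    isStrictTotalOrder : IsStrictTotalOrder _≡_ _<_
    0≢1     : 0# ≢ 1#
    inverse : ∀ x → x ≢ 0# → ∃ λ y → x * y ≡ 1#
    +-mono-< : ∀ x y z → x < y → x + z < y + z
    *-pos   : ∀ x y → 0# < x → 0# < y → 0# < x * y

  _≤_ : Rel Carrier 0ℓ
  x ≤ y = x < y ⊎ x ≡ y

  _-_ : Op₂ Carrier
  x - y = x + (- y)

  UpperBound : (Carrier → Set) → Carrier → Set
  UpperBound S b = ∀ x → S x → x ≤ b

  field
    sup : ∀ (S : Carrier → Set) → ∃ S → ∃ (UpperBound S) →
          ∃ λ s → UpperBound S s × (∀ b → UpperBound S b → s ≤ b)

module Geometry (R : RealField) where
  open RealField R

  Point : Set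
  Point = Carrier × Carrier

  det : Point → Point → Point → Carrier
  det (px , py) (qx , qy) (rx , ry) =
    ((qx - px) * (ry - py)) - ((qy - py) * (rx - px))

  Collinear : Point → Point → Point → Set
  Collinear p q r = det p q r ≡ 0#

  GeneralPosition : ∀ {n} → (Fin n → Point) → Set
  GeneralPosition {n} p = ∀ (i j k : Fin n) → i ≢ j → j ≢ k → i ≢ k →
                          ¬ Collinear (p i) (p j) (p k)

  OnSegment : Point → Point → Point → Set
  OnSegment (ax , ay) (bx , by) x =
    ∃ λ t → (0# ≤ t) × (t ≤ 1#) × (x ≡ (ax + t * (bx - ax) , ay + t * (by - ay)))

  sumF : ∀ {n} → (Fin n → Carrier) → Carrier
  sumF {zero}  f = 0#
  sumF {suc n} f = f Fin.zero + sumF (λ i → f (Fin.suc i))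

  InHullWithout : ∀ {n} → (Fin n → Point) → Fin n → Point → Set
  InHullWithout {n} p i x = ∃ λ (c : Fin n → Carrier) →
    (c i ≡ 0#) × (∀ j → 0# ≤ c j) × (sumF c ≡ 1#) ×
    (x ≡ (sumF (λ j → c j * proj₁ (p j)) , sumF (λ j → c j * proj₂ (p j))))

  ConvexPosition : ∀ {n} → (Fin n → Point) → Set
  ConvexPosition {n} p = ∀ i → ¬ InHullWithout p i (p i)

  -- segments of an n-point set: unordered pairs {i, j}, i < j
  Segment : ℕ → Set
  Segment n = Σ (Fin n × Fin n) λ ij → proj₁ ij Fin.< proj₂ ij

  segPts : ∀ {n} → (Fin n → Point) → Segment n → Point × Point
  segPts p ((i , j) , _) = p i , p j

  DisjointSeg : ∀ {n} → (Fin n → Point) → Segment n → Segment n → Set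
  DisjointSeg p s t =
    ¬ (∃ λ x → OnSegment (proj₁ (segPts p s)) (proj₂ (segPts p s)) x ×
               OnSegment (proj₁ (segPts p t)) (proj₂ (segPts p t)) x)

next : ∀ {k} → Fin (suc k) → Fin (suc k)
next {k} i = fromℕ< (m%n<n (suc (toℕ i)) (suc k))

-- A graph (vertex type V, adjacency E) is hamiltonian if there is a
-- cycle with m ≥ 3 vertices visiting every vertex exactly once.
Hamiltonian : (V : Set) → (V → V → Set) → Set
Hamiltonian V E = ∃ λ k → (2 ℕ.≤ k) × Σ (Fin (suc k) ⤖ V) λ f →
  ∀ i → E (Function.Bundles.Bijection.to f i) (Function.Bundles.Bijection.to f (next i))

{-# OPTIONS --safe #-}
module Submission where

-- Two segments sharing an endpoint meet, so D(P) is a subgraph of the Kneser graph K(n,2) on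
-- the pairs of labels, and for n ≤ 5 that graph has no Hamiltonian cycle (for n = 5 it is the
-- Petersen graph). For a convex hexagon in general position, sorting the points by angle around
-- one of them puts them in convex order: an out-of-order triple would put a point inside the
-- triangle of three others. In convex order two segments with interleaved endpoints cross, so D(P)
-- is a subgraph of the disjointness graph of the chords of a convex hexagon, which has no
-- Hamiltonian cycle either. Both finite graphs are ruled out by exhaustive search.

open import Defs
open import Algebra.Bundles using (CommutativeRing; RawRing)
open import Data.Bool using (Bool; true; false; if_then_else_; _∧_; T)
open import Data.Bool.ListAction using (any)
open import Data.Bool.Properties using (T-∧)
open import Data.Empty using (⊥)
open import Data.Fin as Fin
  using (Fin; toℕ; fromℕ; fromℕ<; inject₁; punchOut) renaming (zero to fzero; suc to fsuc)
open import Data.Fin.Permutation as Permutation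
  using (Permutation′; permutation; _⟨$⟩ʳ_; _⟨$⟩ˡ_; inverseˡ; inverseʳ)
import Data.Fin.Properties as Finₚ
open import Data.List using (List; []; _∷_; _++_; length; tabulate; filter; cartesianProduct; allFin)
open import Data.List.Properties using (++-identityʳ; filter-notAll; length-tabulate)
open import Data.List.Membership.Propositional using (_∈_)
open import Data.List.Membership.Propositional.Properties
  using (∈-∃++; ∈-tabulate⁺; ∈-tabulate⁻; ∈-filter⁺; ∈-filter⁻; ∈-cartesianProduct⁺; ∈-allFin)
open import Data.List.Membership.Propositional.Properties.WithK using (unique∧set⇒bag)
open import Data.List.Relation.Binary.BagAndSetEquality using (∼bag⇒↭)
open import Data.List.Relation.Binary.Permutation.Propositional
  using (_↭_; ↭-refl; ↭-sym; ↭-trans; ↭-prep; ↭-swap)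
open import Data.List.Relation.Binary.Permutation.Propositional.Properties
  using (∈-resp-↭; drop-∷; ↭-length; shift; ++-comm)
open import Data.List.Relation.Unary.Any as Any using (here; there)
open import Data.List.Relation.Unary.Any.Properties using (any⁺)
open import Data.List.Relation.Unary.Unique.Propositional using (Unique)
open import Data.List.Relation.Unary.Unique.Propositional.Properties
  using (tabulate⁺; filter⁺; cartesianProduct⁺; allFin⁺)
open import Data.Maybe using (just; nothing)
open import Data.Nat as ℕ using (ℕ; zero; suc; _∸_; _≡ᵇ_; z≤n; s≤s)
open import Data.Nat.DivMod using (m≤n⇒m%n≡m; n%n≡0)
import Data.Nat.Properties as ℕₚ
open import Data.Product using (Σ; ∃; _×_; _,_; proj₁; proj₂; uncurry)
open import Data.Product.Properties using (≡-dec; ,-injective)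
open import Data.Sum using (_⊎_; inj₁; inj₂; [_,_])
open import Data.Unit using (tt)
open import Function.Base using (_∘_; id)
open import Function.Bundles using (Equivalence; Bijection; _⇔_; mk⇔)
open import Function.Definitions using (Injective)
open import Level using (0ℓ)
open import Relation.Binary.Core using (Rel)
open import Relation.Binary.Definitions
  using (Decidable; DecidableEquality; WeaklyDecidable; Trichotomous; tri<; tri≈; tri>)
open import Relation.Binary.PropositionalEquality
  using (_≡_; _≢_; refl; sym; trans; cong; cong₂; subst; subst₂; isEquivalence; resp₂; module ≡-Reasoning)
open import Relation.Binary.Structures using (IsStrictTotalOrder)
open import Relation.Nullary using (¬_; yes; no; does; contradiction; ¬?)
open import Relation.Nullary.Decidable using (isYes; fromWitness; _⊎-dec_; _×-dec_)
import Relation.Unary as Pred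

module IntegerCoefficientSolver {c ℓ} (R : CommutativeRing c ℓ) where
  open CommutativeRing R renaming (refl to ≈-refl; sym to ≈-sym; trans to ≈-trans)
  open import Algebra.Properties.Semiring.Mult semiring using (×-homo-+; ×1-homo-*) renaming (_×_ to _×ᴿ_)
  open import Algebra.Properties.Ring ring using (-‿+-comm; ⁻¹-anti-homo‿-; x[y-z]≈xy-xz; [y-z]x≈yx-zx; -0#≈0#)
  open import Algebra.Properties.CommutativeSemigroup +-commutativeSemigroup using (interchange)
  import Algebra.Solver.Ring.AlmostCommutativeRing as ACR
  open import Relation.Binary.Reasoning.Setoid setoid

  private
    -- ℤ as differences m - n in the normal form with one side 0: equal coefficients are then
    -- identical terms, which is what lets the solver close goals by refl.
    normalise : ℕ × ℕ → ℕ × ℕ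
    normalise (m , n) = m ∸ n , n ∸ m

    differences : RawRing 0ℓ 0ℓ
    differences = record
      { Carrier = ℕ × ℕ ; _≈_ = _≡_
      ; _+_ = λ { (a , b) (c , d) → normalise (a ℕ.+ c , b ℕ.+ d) }
      ; _*_ = λ { (a , b) (c , d) → normalise (a ℕ.* c ℕ.+ b ℕ.* d , a ℕ.* d ℕ.+ b ℕ.* c) }
      ; -_  = λ { (a , b) → b , a }
      ; 0#  = 0 , 0
      ; 1#  = 1 , 0
      }

    ⟦_⟧ : ℕ × ℕ → Carrier
    ⟦ m , n ⟧ = m ×ᴿ 1# - n ×ᴿ 1#

    [x+z]-[y+w]≈[x-y]+[z-w] : ∀ x y z w → (x + z) - (y + w) ≈ (x - y) + (z - w)
    [x+z]-[y+w]≈[x-y]+[z-w] x y z w = begin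
      (x + z) - (y + w)      ≈⟨ +-congˡ (-‿+-comm y w) ⟨
      (x + z) + (- y + - w)  ≈⟨ interchange x z (- y) (- w) ⟩
      (x - y) + (z - w)      ∎

    x+v≈y+u⇒x-y≈u-v : ∀ {x y u v} → x + v ≈ y + u → x - y ≈ u - v
    x+v≈y+u⇒x-y≈u-v {x} {y} {u} {v} eq = begin
      x - y                  ≈⟨ +-identityʳ (x - y) ⟨
      (x - y) + 0#           ≈⟨ +-congˡ (-‿inverseʳ v) ⟨
      (x - y) + (v - v)      ≈⟨ [x+z]-[y+w]≈[x-y]+[z-w] x y v v ⟨
      (x + v) - (y + v)      ≈⟨ +-congʳ eq ⟩
      (y + u) - (y + v)      ≈⟨ [x+z]-[y+w]≈[x-y]+[z-w] y y u v ⟩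
      (y - y) + (u - v)      ≈⟨ +-congʳ (-‿inverseʳ y) ⟩
      0# + (u - v)           ≈⟨ +-identityˡ (u - v) ⟩
      u - v                  ∎

    [x-y][z-w]≈[xz+yw]-[xw+yz] : ∀ x y z w → (x - y) * (z - w) ≈ (x * z + y * w) - (x * w + y * z)
    [x-y][z-w]≈[xz+yw]-[xw+yz] x y z w = begin
      (x - y) * (z - w)                  ≈⟨ x[y-z]≈xy-xz (x - y) z w ⟩
      (x - y) * z - (x - y) * w          ≈⟨ +-cong ([y-z]x≈yx-zx z x y) (-‿cong ([y-z]x≈yx-zx w x y)) ⟩
      (x * z - y * z) - (x * w - y * w)  ≈⟨ +-congˡ (⁻¹-anti-homo‿- (x * w) (y * w)) ⟩
      (x * z - y * z) + (y * w - x * w)  ≈⟨ [x+z]-[y+w]≈[x-y]+[z-w] (x * z) (y * z) (y * w) (x * w) ⟨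
      (x * z + y * w) - (y * z + x * w)  ≈⟨ +-congˡ (-‿cong (+-comm (y * z) (x * w))) ⟩
      (x * z + y * w) - (x * w + y * z)  ∎

    [m∸n]+n≡[n∸m]+m : ∀ m n → (m ∸ n) ℕ.+ n ≡ (n ∸ m) ℕ.+ m
    [m∸n]+n≡[n∸m]+m zero    zero    = refl
    [m∸n]+n≡[n∸m]+m zero    (suc n) = ℕₚ.+-comm 0 (suc n)
    [m∸n]+n≡[n∸m]+m (suc m) zero    = ℕₚ.+-comm (suc m) 0
    [m∸n]+n≡[n∸m]+m (suc m) (suc n) =
      trans (ℕₚ.+-suc (m ∸ n) n) (trans (cong suc ([m∸n]+n≡[n∸m]+m m n)) (sym (ℕₚ.+-suc (n ∸ m) m)))

    ⟦⟧-cong : ∀ a b c d → a ℕ.+ d ≡ b ℕ.+ c → ⟦ a , b ⟧ ≈ ⟦ c , d ⟧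
    ⟦⟧-cong a b c d eq = x+v≈y+u⇒x-y≈u-v (begin
      a ×ᴿ 1# + d ×ᴿ 1#   ≈⟨ ×-homo-+ 1# a d ⟨
      (a ℕ.+ d) ×ᴿ 1#     ≡⟨ cong (_×ᴿ 1#) eq ⟩
      (b ℕ.+ c) ×ᴿ 1#     ≈⟨ ×-homo-+ 1# b c ⟩
      b ×ᴿ 1# + c ×ᴿ 1#   ∎)

    ⟦normalise⟧ : ∀ m n → ⟦ normalise (m , n) ⟧ ≈ ⟦ m , n ⟧
    ⟦normalise⟧ m n = ⟦⟧-cong (m ∸ n) (n ∸ m) m n ([m∸n]+n≡[n∸m]+m m n)

    ⟦⟧-homo-+ : ∀ a b c d → ⟦ a ℕ.+ c , b ℕ.+ d ⟧ ≈ ⟦ a , b ⟧ + ⟦ c , d ⟧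
    ⟦⟧-homo-+ a b c d = begin
      (a ℕ.+ c) ×ᴿ 1# - (b ℕ.+ d) ×ᴿ 1#          ≈⟨ +-cong (×-homo-+ 1# a c) (-‿cong (×-homo-+ 1# b d)) ⟩
      (a ×ᴿ 1# + c ×ᴿ 1#) - (b ×ᴿ 1# + d ×ᴿ 1#)  ≈⟨ [x+z]-[y+w]≈[x-y]+[z-w] _ _ _ _ ⟩
      ⟦ a , b ⟧ + ⟦ c , d ⟧                      ∎

    ⟦⟧-homo-* : ∀ a b c d → ⟦ a ℕ.* c ℕ.+ b ℕ.* d , a ℕ.* d ℕ.+ b ℕ.* c ⟧ ≈ ⟦ a , b ⟧ * ⟦ c , d ⟧
    ⟦⟧-homo-* a b c d = begin
      ⟦ a ℕ.* c ℕ.+ b ℕ.* d , a ℕ.* d ℕ.+ b ℕ.* c ⟧  ≈⟨ ⟦⟧-homo-+ (a ℕ.* c) (a ℕ.* d) (b ℕ.* d) (b ℕ.* c) ⟩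
      ⟦ a ℕ.* c , a ℕ.* d ⟧ + ⟦ b ℕ.* d , b ℕ.* c ⟧  ≈⟨ +-cong (+-cong (×1-homo-* a c) (-‿cong (×1-homo-* a d)))
                                                                (+-cong (×1-homo-* b d) (-‿cong (×1-homo-* b c))) ⟩
      (A * C - A * D) + (B * D - B * C)              ≈⟨ [x+z]-[y+w]≈[x-y]+[z-w] (A * C) (A * D) (B * D) (B * C) ⟨
      (A * C + B * D) - (A * D + B * C)              ≈⟨ [x-y][z-w]≈[xz+yw]-[xw+yz] A B C D ⟨
      ⟦ a , b ⟧ * ⟦ c , d ⟧                          ∎
      where
      A = a ×ᴿ 1#
      B = b ×ᴿ 1#
      C = c ×ᴿ 1#
      D = d ×ᴿ 1#

    homomorphism : differences ACR.-Raw-AlmostCommutative⟶ ACR.fromCommutativeRing R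
    homomorphism = record
      { ⟦_⟧    = ⟦_⟧
      ; +-homo = λ { (a , b) (c , d) → ≈-trans (⟦normalise⟧ (a ℕ.+ c) (b ℕ.+ d)) (⟦⟧-homo-+ a b c d) }
      ; *-homo = λ { (a , b) (c , d) → ≈-trans (⟦normalise⟧ (a ℕ.* c ℕ.+ b ℕ.* d) (a ℕ.* d ℕ.+ b ℕ.* c))
                                               (⟦⟧-homo-* a b c d) }
      ; -‿homo = λ { (a , b) → ≈-sym (⁻¹-anti-homo‿- _ _) }
      ; 0-homo = -‿inverseʳ 0#
      ; 1-homo = ≈-trans (+-congˡ -0#≈0#) (≈-trans (+-identityʳ _) (+-identityʳ 1#))
      }

    decide : WeaklyDecidable (ACR.Induced-equivalence homomorphism)
    decide (a , b) (c , d) with a ℕ.+ d ≡ᵇ b ℕ.+ c in eq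
    ... | true  = just (⟦⟧-cong a b c d (ℕₚ.≡ᵇ⇒≡ _ _ (subst T (sym eq) tt)))
    ... | false = nothing

  open import Algebra.Solver.Ring differences (ACR.fromCommutativeRing R) homomorphism decide public
    using (solve; _:=_; _:+_; _:*_; _:-_; :-_; Polynomial)

module _ {A : Set} {P Q : Pred.Pred A 0ℓ} (P? : Pred.Decidable P) (Q? : Pred.Decidable Q)
         (P⊆Q : ∀ {x} → P x → Q x) where

  length-filter-mono : ∀ xs → length (filter P? xs) ℕ.≤ length (filter Q? xs)
  length-filter-mono []       = z≤n
  length-filter-mono (x ∷ xs) with P? x | Q? x
  ... | yes _  | yes _  = s≤s (length-filter-mono xs)
  ... | yes px | no ¬qx = contradiction (P⊆Q px) ¬qx
  ... | no _   | yes _  = ℕₚ.m≤n⇒m≤1+n (length-filter-mono xs)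
  ... | no _   | no _   = length-filter-mono xs

  length-filter-< : ∀ {x xs} → x ∈ xs → ¬ P x → Q x → length (filter P? xs) ℕ.< length (filter Q? xs)
  length-filter-< {x} {x ∷ xs} (here refl) ¬px qx with P? x | Q? x
  ... | yes px | _      = contradiction px ¬px
  ... | no _   | yes _  = s≤s (length-filter-mono xs)
  ... | no _   | no ¬qx = contradiction qx ¬qx
  length-filter-< {xs = y ∷ xs} (there x∈xs) ¬px qx with P? y | Q? y
  ... | yes _  | yes _  = s≤s (length-filter-< x∈xs ¬px qx)
  ... | yes py | no ¬qy = contradiction (P⊆Q py) ¬qy
  ... | no _   | yes _  = ℕₚ.m≤n⇒m≤1+n (length-filter-< x∈xs ¬px qx)
  ... | no _   | no _   = length-filter-< x∈xs ¬px qx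

injective⇒surjective : ∀ {n} {f : Fin n → Fin n} → Injective _≡_ _≡_ f → ∀ y → ∃ λ x → f x ≡ y
injective⇒surjective {suc n} {f} f-injective y with Finₚ.any? (λ x → f x Finₚ.≟ y)
... | yes hit = hit
... | no ¬hit = contradiction (Finₚ.injective⇒≤ g-injective) (ℕₚ.n≮n n)
  where
  missed : ∀ x → y ≢ f x
  missed x y≡fx = ¬hit (x , sym y≡fx)
  g : Fin (suc n) → Fin n
  g x = punchOut (missed x)
  g-injective : Injective _≡_ _≡_ g
  g-injective {x} {x′} = f-injective ∘ Finₚ.punchOut-injective (missed x) (missed x′)

module Ranking {n} {_≺_ : Rel (Fin n) 0ℓ} (≺-isStrictTotalOrder : IsStrictTotalOrder _≡_ _≺_) where
  open IsStrictTotalOrder ≺-isStrictTotalOrder using (compare; _<?_) renaming (trans to ≺-trans; irrefl to ≺-irrefl)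

  rank : Fin n → ℕ
  rank j = length (filter (_<? j) (allFin n))

  rank-mono : ∀ {i j} → i ≺ j → rank i ℕ.< rank j
  rank-mono {i} {j} i≺j =
    length-filter-< (_<? i) (_<? j) (λ k≺i → ≺-trans k≺i i≺j) (∈-allFin i) (≺-irrefl refl) i≺j

  rank<n : ∀ j → rank j ℕ.< n
  rank<n j = subst (rank j ℕ.<_) (length-tabulate id)
    (filter-notAll (_<? j) (allFin n) (Any.map (λ { refl → ≺-irrefl refl }) (∈-allFin j)))

  rank-reflects : ∀ {i j} → rank i ℕ.< rank j → i ≺ j
  rank-reflects {i} {j} rank-i<rank-j with compare i j
  ... | tri< i≺j _ _  = i≺j
  ... | tri≈ _ refl _ = contradiction rank-i<rank-j (ℕₚ.<-irrefl refl)
  ... | tri> _ _ j≺i  = contradiction (rank-mono j≺i) (ℕₚ.<-asym rank-i<rank-j)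

  position : Fin n → Fin n
  position j = fromℕ< (rank<n j)

  toℕ-position : ∀ j → toℕ (position j) ≡ rank j
  toℕ-position j = Finₚ.toℕ-fromℕ< (rank<n j)

  rank-injective : ∀ {i j} → rank i ≡ rank j → i ≡ j
  rank-injective {i} {j} eq with compare i j
  ... | tri< i≺j _ _ = contradiction (rank-mono i≺j) (ℕₚ.<-irrefl eq)
  ... | tri≈ _ i≡j _ = i≡j
  ... | tri> _ _ j≺i = contradiction (rank-mono j≺i) (ℕₚ.<-irrefl (sym eq))

  position-injective : Injective _≡_ _≡_ position
  position-injective {i} {j} eq = rank-injective (trans (sym (toℕ-position i)) (trans (cong toℕ eq) (toℕ-position j)))

  ranking : Permutation′ n
  ranking = permutation position (proj₁ ∘ surjective) (proj₂ ∘ surjective)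
                        (λ j → position-injective (proj₂ (surjective (position j))))
    where surjective = injective⇒surjective position-injective

  ranking⁻¹-mono : ∀ {a b} → a Fin.< b → (ranking ⟨$⟩ˡ a) ≺ (ranking ⟨$⟩ˡ b)
  ranking⁻¹-mono {a} {b} = rank-reflects ∘ subst₂ ℕ._<_ (rank-of-preimage a) (rank-of-preimage b)
    where
    rank-of-preimage : ∀ a → toℕ a ≡ rank (ranking ⟨$⟩ˡ a)
    rank-of-preimage a = trans (cong toℕ (sym (inverseʳ ranking))) (toℕ-position _)

next-inject₁ : ∀ {k} (i : Fin k) → next (inject₁ i) ≡ fsuc i
next-inject₁ {k} i = Finₚ.toℕ-injective (begin
  toℕ (next (inject₁ i))          ≡⟨ Finₚ.toℕ-fromℕ< _ ⟩
  suc (toℕ (inject₁ i)) ℕ.% suc k ≡⟨ cong (λ m → suc m ℕ.% suc k) (Finₚ.toℕ-inject₁ i) ⟩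
  suc (toℕ i) ℕ.% suc k           ≡⟨ m≤n⇒m%n≡m (Finₚ.toℕ<n i) ⟩
  suc (toℕ i)                     ∎)
  where open ≡-Reasoning

next-fromℕ : ∀ k → next (fromℕ k) ≡ fzero
next-fromℕ k = Finₚ.toℕ-injective (begin
  toℕ (next (fromℕ k))            ≡⟨ Finₚ.toℕ-fromℕ< _ ⟩
  suc (toℕ (fromℕ k)) ℕ.% suc k   ≡⟨ cong (λ m → suc m ℕ.% suc k) (Finₚ.toℕ-fromℕ k) ⟩
  suc k ℕ.% suc k                 ≡⟨ n%n≡0 (suc k) ⟩
  0                               ∎)
  where open ≡-Reasoning

-- Hamiltonian cycles are searched for from the first vertex only: every cycle can be rotated
-- to start there.
module HamiltonianCycleSearch {V : Set} (_≟_ : DecidableEquality V) {_~_ : Rel V 0ℓ} (_~?_ : Decidable _~_) where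

  Path : V → List V → V → Set
  Path u []       w = u ~ w
  Path u (x ∷ xs) w = u ~ x × Path x xs w

  ClosedWalk : List V → Set
  ClosedWalk []       = ⊥
  ClosedWalk (u ∷ xs) = Path u xs u

  path-++ : ∀ {u m w} xs {ys} → Path u xs m → Path m ys w → Path u (xs ++ m ∷ ys) w
  path-++ []       u~m           path = u~m , path
  path-++ (x ∷ xs) (u~x , path₁) path = u~x , path-++ xs path₁ path

  path-split : ∀ {u m w} xs {ys} → Path u (xs ++ m ∷ ys) w → Path u xs m × Path m ys w
  path-split []       (u~m , path) = u~m , path
  path-split (x ∷ xs) (u~x , path) with path₁ , path₂ ← path-split xs path = (u~x , path₁) , path₂

  closedWalk-rotate : ∀ xs {v ys} → ClosedWalk (xs ++ v ∷ ys) → Path v (ys ++ xs) v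
  closedWalk-rotate []       {ys = ys} walk rewrite ++-identityʳ ys = walk
  closedWalk-rotate (x ∷ xs) {ys = ys} walk with path₁ , path₂ ← path-split xs walk = path-++ ys path₂ path₁

  _∖_ : List V → V → List V
  []       ∖ w = []
  (x ∷ xs) ∖ w = if does (w ≟ x) then xs else x ∷ (xs ∖ w)

  ∈⇒↭∷∖ : ∀ {w xs} → w ∈ xs → xs ↭ w ∷ (xs ∖ w)
  ∈⇒↭∷∖ {w} {x ∷ xs} w∈ with w ≟ x
  ... | yes refl = ↭-refl
  ∈⇒↭∷∖ (here refl)             | no w≢w = contradiction refl w≢w
  ∈⇒↭∷∖ {w} {x ∷ xs} (there w∈) | no _   = ↭-trans (↭-prep x (∈⇒↭∷∖ w∈)) (↭-swap x w ↭-refl)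

  -- canReturn start U cur k: with k = length U, the vertices of U can be visited in some order
  -- along a path that starts next to cur and ends next to start.
  canReturn : V → List V → V → ℕ → Bool
  canReturn start U cur zero    = isYes (cur ~? start)
  canReturn start U cur (suc k) = any (λ w → isYes (cur ~? w) ∧ canReturn start (U ∖ w) w k) U

  canReturn-complete : ∀ {start U cur} rs → Path cur rs start → U ↭ rs → T (canReturn start U cur (length rs))
  canReturn-complete []       cur~start _ = fromWitness cur~start
  canReturn-complete {U = U} (r ∷ rs) (cur~r , path) U↭r∷rs =
    any⁺ _ (Any.map (λ { refl → Equivalence.from T-∧ (fromWitness cur~r , onwards) }) r∈U)
    where
    r∈U : r ∈ U
    r∈U = ∈-resp-↭ (↭-sym U↭r∷rs) (here refl)
    onwards = canReturn-complete rs path (drop-∷ (↭-trans (↭-sym (∈⇒↭∷∖ r∈U)) U↭r∷rs))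

  hasHamiltonianCycle : List V → Bool
  hasHamiltonianCycle []       = false
  hasHamiltonianCycle (v ∷ vs) = canReturn v vs v (length vs)

  closedWalk⇒hasHamiltonianCycle : ∀ {cs vs} → ClosedWalk cs → cs ↭ vs → T (hasHamiltonianCycle vs)
  closedWalk⇒hasHamiltonianCycle {[]}    ()
  closedWalk⇒hasHamiltonianCycle {_ ∷ _} {[]} _ cs↭ with () ← ↭-length cs↭
  closedWalk⇒hasHamiltonianCycle {vs = v ∷ vs} walk cs↭
    with xs , ys , refl ← ∈-∃++ (∈-resp-↭ (↭-sym cs↭) (here refl))
    = subst (T ∘ canReturn v vs v) (↭-length (↭-sym vs↭ys++xs))
        (canReturn-complete (ys ++ xs) (closedWalk-rotate xs walk) vs↭ys++xs)
    where
    vs↭ys++xs : vs ↭ ys ++ xs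
    vs↭ys++xs = drop-∷ (↭-trans (↭-sym cs↭) (↭-trans (shift v xs ys) (↭-prep v (++-comm xs ys))))

  tabulate-path : ∀ {m w} (g : Fin (suc m) → V) → (∀ i → g (inject₁ i) ~ g (fsuc i)) →
                  g (fromℕ m) ~ w → Path (g fzero) (tabulate (g ∘ fsuc)) w
  tabulate-path {zero}  g step last = last
  tabulate-path {suc m} g step last = step fzero , tabulate-path (g ∘ fsuc) (step ∘ fsuc) last

  tabulate-closedWalk : ∀ {k} (g : Fin (suc k) → V) → (∀ i → g i ~ g (next i)) → ClosedWalk (tabulate g)
  tabulate-closedWalk {k} g edge =
    tabulate-path g (λ i → subst (λ j → g (inject₁ i) ~ g j) (next-inject₁ i) (edge (inject₁ i)))
                    (subst (λ j → g (fromℕ k) ~ g j) (next-fromℕ k) (edge (fromℕ k)))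

  module _ {S : Set} {E : Rel S 0ℓ} (φ : S → V) (φ-injective : Injective _≡_ _≡_ φ)
           (φ-edge : ∀ {s t} → E s t → φ s ~ φ t)
           {vs : List V} (vs-unique : Unique vs) (vs-image : ∀ {v} → v ∈ vs ⇔ ∃ λ s → φ s ≡ v) where

    hamiltonian⇒hasHamiltonianCycle : Hamiltonian S E → T (hasHamiltonianCycle vs)
    hamiltonian⇒hasHamiltonianCycle (k , _ , f , edge) =
      closedWalk⇒hasHamiltonianCycle (tabulate-closedWalk c (φ-edge ∘ edge)) cycle↭vs
      where
      open Bijection f using (to; injective; strictlySurjective)
      c : Fin (suc k) → V
      c = φ ∘ to
      cycle↭vs : tabulate c ↭ vs
      cycle↭vs = ∼bag⇒↭ (unique∧set⇒bag (tabulate⁺ (injective ∘ φ-injective)) vs-unique (λ {v} → mk⇔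
        (λ v∈ → let i , v≡ci = ∈-tabulate⁻ {f = c} v∈ in Equivalence.from vs-image (to i , sym v≡ci))
        (λ v∈ → let s , φs≡v = Equivalence.to vs-image v∈ ; i , to-i≡s = strictlySurjective s in
                  subst (_∈ tabulate c) (trans (cong φ to-i≡s) φs≡v) (∈-tabulate⁺ {f = c} i))))

Edge : ℕ → Set
Edge n = Σ (Fin n × Fin n) λ ij → proj₁ ij Fin.< proj₂ ij

Code : ℕ → Set
Code n = Fin n × Fin n

increasingPairs : ∀ n → List (Code n)
increasingPairs n = filter (uncurry Finₚ._<?_) (cartesianProduct (allFin n) (allFin n))

increasingPairs-unique : ∀ n → Unique (increasingPairs n)
increasingPairs-unique n = filter⁺ (uncurry Finₚ._<?_) (cartesianProduct⁺ (allFin⁺ n) (allFin⁺ n))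

∈-increasingPairs : ∀ {n} {a b : Fin n} → (a , b) ∈ increasingPairs n ⇔ a Fin.< b
∈-increasingPairs {n} = mk⇔
  (proj₂ ∘ ∈-filter⁻ (uncurry Finₚ._<?_) {xs = cartesianProduct (allFin n) (allFin n)})
  (∈-filter⁺ (uncurry Finₚ._<?_) (∈-cartesianProduct⁺ (∈-allFin _) (∈-allFin _)))

sortPair : ∀ {n} → Fin n → Fin n → Code n
sortPair a b with a Finₚ.<? b
... | yes _ = a , b
... | no  _ = b , a

sortPair-< : ∀ {n} {a b : Fin n} → a Fin.< b → sortPair a b ≡ (a , b)
sortPair-< {a = a} {b} a<b with a Finₚ.<? b
... | yes _   = refl
... | no a≮b = contradiction a<b a≮b

sortPair-> : ∀ {n} {a b : Fin n} → b Fin.< a → sortPair a b ≡ (b , a)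
sortPair-> {a = a} {b} b<a with a Finₚ.<? b
... | yes a<b = contradiction b<a (Finₚ.<-asym a<b)
... | no  _   = refl

sortPair-cases : ∀ {n} (a b : Fin n) → sortPair a b ≡ (a , b) ⊎ sortPair a b ≡ (b , a)
sortPair-cases a b with a Finₚ.<? b
... | yes _ = inj₁ refl
... | no  _ = inj₂ refl

sortPair-increasing : ∀ {n} {a b : Fin n} → a ≢ b → uncurry Fin._<_ (sortPair a b)
sortPair-increasing {a = a} {b} a≢b with Finₚ.<-cmp a b
... | tri< a<b _ _ rewrite sortPair-< a<b = a<b
... | tri≈ _ a≡b _ = contradiction a≡b a≢b
... | tri> _ _ b<a rewrite sortPair-> b<a = b<a

sortPair-injective : ∀ {n} {a b c d : Fin n} → sortPair a b ≡ sortPair c d → (a ≡ c × b ≡ d) ⊎ (a ≡ d × b ≡ c)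
sortPair-injective {a = a} {b} {c} {d} eq with sortPair-cases a b | sortPair-cases c d
... | inj₁ ab | inj₁ cd = inj₁ (,-injective (trans (sym ab) (trans eq cd)))
... | inj₁ ab | inj₂ dc = inj₂ (,-injective (trans (sym ab) (trans eq dc)))
... | inj₂ ba | inj₁ cd = let b≡c , a≡d = ,-injective (trans (sym ba) (trans eq cd)) in inj₂ (a≡d , b≡c)
... | inj₂ ba | inj₂ dc = let b≡d , a≡c = ,-injective (trans (sym ba) (trans eq dc)) in inj₁ (a≡c , b≡d)

module _ {n} (σ : Permutation′ n) where

  σ-injective : Injective _≡_ _≡_ (σ ⟨$⟩ʳ_)
  σ-injective eq = trans (sym (inverseˡ σ)) (trans (cong (σ ⟨$⟩ˡ_) eq) (inverseˡ σ))

  code : Edge n → Code n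
  code ((i , j) , _) = sortPair (σ ⟨$⟩ʳ i) (σ ⟨$⟩ʳ j)

  code-injective : Injective _≡_ _≡_ code
  code-injective {(i , j) , i<j} {(k , l) , k<l} eq with sortPair-injective eq
  ... | inj₁ (σi≡σk , σj≡σl) with refl ← σ-injective σi≡σk | refl ← σ-injective σj≡σl =
    cong ((i , j) ,_) (Finₚ.<-irrelevant i<j k<l)
  ... | inj₂ (σi≡σl , σj≡σk) with refl ← σ-injective σi≡σl | refl ← σ-injective σj≡σk =
    contradiction k<l (Finₚ.<-asym i<j)

  code-image : ∀ {v} → v ∈ increasingPairs n ⇔ ∃ λ e → code e ≡ v
  code-image {a , b} = mk⇔ (hit ∘ Equivalence.to ∈-increasingPairs) λ (e , code-e≡ab) →
    Equivalence.from ∈-increasingPairs (subst (uncurry Fin._<_) code-e≡ab (code-increasing e))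
    where
    code-increasing : ∀ e → uncurry Fin._<_ (code e)
    code-increasing ((i , j) , i<j) = sortPair-increasing (Finₚ.<⇒≢ i<j ∘ σ-injective)
    hit : a Fin.< b → ∃ λ e → code e ≡ (a , b)
    hit a<b with Finₚ.<-cmp (σ ⟨$⟩ˡ a) (σ ⟨$⟩ˡ b)
    ... | tri< i<j _ _ = (_ , i<j) , trans (cong₂ sortPair (inverseʳ σ) (inverseʳ σ)) (sortPair-< a<b)
    ... | tri≈ _ i≡j _ = contradiction (trans (sym (inverseʳ σ)) (trans (cong (σ ⟨$⟩ʳ_) i≡j) (inverseʳ σ)))
                                       (Finₚ.<⇒≢ a<b)
    ... | tri> _ _ j<i = (_ , j<i) , trans (cong₂ sortPair (inverseʳ σ) (inverseʳ σ)) (sortPair-> a<b)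

SharesEndpoint : ∀ {n} → Rel (Code n) 0ℓ
SharesEndpoint (a , b) (c , d) = a ≡ c ⊎ a ≡ d ⊎ b ≡ c ⊎ b ≡ d

Interleaved : ∀ {n} → Rel (Code n) 0ℓ
Interleaved (a , b) (c , d) = (a Fin.< c × c Fin.< b × b Fin.< d) ⊎ (c Fin.< a × a Fin.< d × d Fin.< b)

sharesEndpoint? : ∀ {n} → Decidable (SharesEndpoint {n})
sharesEndpoint? (a , b) (c , d) = a Finₚ.≟ c ⊎-dec a Finₚ.≟ d ⊎-dec b Finₚ.≟ c ⊎-dec b Finₚ.≟ d

sharesEndpointOrInterleaved? : ∀ {n} → Decidable (λ u v → SharesEndpoint {n} u v ⊎ Interleaved u v)
sharesEndpointOrInterleaved? u@(a , b) v@(c , d) = sharesEndpoint? u v ⊎-dec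
  ((a Finₚ.<? c ×-dec c Finₚ.<? b ×-dec b Finₚ.<? d) ⊎-dec (c Finₚ.<? a ×-dec a Finₚ.<? d ×-dec d Finₚ.<? b))

hasCycleAvoiding : ∀ {n} {M : Rel (Code n) 0ℓ} → Decidable M → List (Code n) → Bool
hasCycleAvoiding M? = HamiltonianCycleSearch.hasHamiltonianCycle (≡-dec Finₚ._≟_ Finₚ._≟_) (λ u v → ¬? (M? u v))

kneser-nonHamiltonian : ∀ {n} → n ℕ.≤ 5 → hasCycleAvoiding sharesEndpoint? (increasingPairs n) ≡ false
kneser-nonHamiltonian {0} _ = refl
kneser-nonHamiltonian {1} _ = refl
kneser-nonHamiltonian {2} _ = refl
kneser-nonHamiltonian {3} _ = refl
kneser-nonHamiltonian {4} _ = refl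
kneser-nonHamiltonian {5} _ = refl
kneser-nonHamiltonian {suc (suc (suc (suc (suc (suc _)))))} (s≤s (s≤s (s≤s (s≤s (s≤s ())))))

hexagonChords-nonHamiltonian : hasCycleAvoiding sharesEndpointOrInterleaved? (increasingPairs 6) ≡ false
hexagonChords-nonHamiltonian = refl

-- RealField's _-_ has no fixity declaration, so it binds tighter than _+_ and _*_:
-- 1# - k * y parses as (1# - k) * y.
module RealFieldProperties (R : RealField) where
  open RealField R
  open IsStrictTotalOrder isStrictTotalOrder using (compare) renaming (irrefl to <-irrefl; trans to <-trans)

  commutativeRing : CommutativeRing 0ℓ 0ℓ
  commutativeRing = record { isCommutativeRing = isCommutativeRing }

  open CommutativeRing commutativeRing public
    using (+-comm; +-identityˡ; +-identityʳ; *-identityˡ; *-identityʳ; zeroˡ; zeroʳ; -‿inverseʳ)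
  open import Algebra.Properties.Ring (CommutativeRing.ring commutativeRing) public
    using (-‿involutive; -1*x≈-x; -0#≈0#)
  open IntegerCoefficientSolver commutativeRing public

  <-asym : ∀ {x y} → x < y → ¬ y < x
  <-asym x<y y<x = <-irrefl refl (<-trans x<y y<x)

  +-pos : ∀ {x y} → 0# < x → 0# < y → 0# < x + y
  +-pos {x} {y} 0<x 0<y = <-trans 0<y (subst (_< x + y) (+-identityˡ y) (+-mono-< 0# x y 0<x))

  neg⇒-pos : ∀ {x} → x < 0# → 0# < - x
  neg⇒-pos {x} x<0 = subst₂ _<_ (-‿inverseʳ x) (+-identityˡ (- x)) (+-mono-< x 0# (- x) x<0)

  -pos⇒neg : ∀ {x} → 0# < - x → x < 0#
  -pos⇒neg {x} 0<-x =
    subst₂ _<_ (+-identityˡ x) (trans (+-comm (- x) x) (-‿inverseʳ x)) (+-mono-< 0# (- x) x 0<-x)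

  pos⇒-neg : ∀ {x} → 0# < x → - x < 0#
  pos⇒-neg {x} 0<x = -pos⇒neg (subst (0# <_) (sym (-‿involutive x)) 0<x)

  0<1 : 0# < 1#
  0<1 with compare 0# 1#
  ... | tri< 0<1 _ _ = 0<1
  ... | tri≈ _ 0≡1 _ = contradiction 0≡1 0≢1
  ... | tri> _ _ 1<0 = contradiction square (<-asym 1<0)
    where
    square : 0# < 1#
    square = subst (0# <_) (trans (-1*x≈-x (- 1#)) (-‿involutive 1#)) (*-pos _ _ (neg⇒-pos 1<0) (neg⇒-pos 1<0))

  nonzero-sign : ∀ {x} → x ≢ 0# → 0# < x ⊎ x < 0#
  nonzero-sign {x} x≢0 with compare 0# x
  ... | tri< 0<x _ _ = inj₁ 0<x
  ... | tri≈ _ 0≡x _ = contradiction (sym 0≡x) x≢0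
  ... | tri> _ _ x<0 = inj₂ x<0

  *-cancelˡ-pos : ∀ {q z} → 0# < q → 0# < q * z → 0# < z
  *-cancelˡ-pos {q} {z} 0<q 0<qz with compare 0# z
  ... | tri< 0<z _ _ = 0<z
  ... | tri≈ _ refl _ = contradiction (zeroʳ q) (λ q0≡0 → <-irrefl (sym q0≡0) 0<qz)
  ... | tri> _ _ z<0 = contradiction 0<qz (<-asym (-pos⇒neg (subst (0# <_) q[-z]≡-[qz] 0<q[-z])))
    where
    0<q[-z] : 0# < q * - z
    0<q[-z] = *-pos q (- z) 0<q (neg⇒-pos z<0)
    q[-z]≡-[qz] : q * - z ≡ - (q * z)
    q[-z]≡-[qz] = solve 2 (λ q z → q :* (:- z) := :- (q :* z)) refl q z

  inverse-pos : ∀ {q} → 0# < q → ∃ λ y → q * y ≡ 1# × 0# < y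
  inverse-pos {q} 0<q with y , qy≡1 ← inverse q (λ q≡0 → <-irrefl (sym q≡0) 0<q) =
    y , qy≡1 , *-cancelˡ-pos 0<q (subst (0# <_) (sym qy≡1) 0<1)

  module _ {q y : Carrier} (qy≡1 : q * y ≡ 1#) where

    inverse-sum : ∀ {k₁ k₂ k₃} → k₁ + (k₂ + k₃) ≡ q → k₁ * y + (k₂ * y + k₃ * y) ≡ 1#
    inverse-sum {k₁} {k₂} {k₃} refl = trans (solve 4 (λ k₁ k₂ k₃ y →
      k₁ :* y :+ (k₂ :* y :+ k₃ :* y) := (k₁ :+ (k₂ :+ k₃)) :* y) refl k₁ k₂ k₃ y) qy≡1

    inverse-combination : ∀ {k₁ k₂ k₃ a b c x} → k₁ * a + (k₂ * b + k₃ * c) ≡ q * x →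
                          (k₁ * y) * a + ((k₂ * y) * b + (k₃ * y) * c) ≡ x
    inverse-combination {k₁} {k₂} {k₃} {a} {b} {c} {x} eq = begin
      (k₁ * y) * a + ((k₂ * y) * b + (k₃ * y) * c) ≡⟨ solve 7 (λ k₁ k₂ k₃ a b c y →
         (k₁ :* y) :* a :+ ((k₂ :* y) :* b :+ (k₃ :* y) :* c) := y :* (k₁ :* a :+ (k₂ :* b :+ k₃ :* c)))
         refl k₁ k₂ k₃ a b c y ⟩
      y * (k₁ * a + (k₂ * b + k₃ * c))             ≡⟨ cong (y *_) eq ⟩
      y * (q * x)                                  ≡⟨ solve 3 (λ y q x → y :* (q :* x) := (q :* y) :* x) refl y q x ⟩
      (q * y) * x                                  ≡⟨ cong (_* x) qy≡1 ⟩
      1# * x                                       ≡⟨ *-identityˡ x ⟩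
      x                                            ∎
      where open ≡-Reasoning

    inverse-affine : ∀ {a b k l u v} → q * a + k * u ≡ q * b + l * v → a + (k * y) * u ≡ b + (l * y) * v
    inverse-affine {a} {b} {k} {l} {u} {v} eq = begin
      a + (k * y) * u              ≡⟨ scale a k u ⟨
      y * (q * a + k * u)          ≡⟨ cong (y *_) eq ⟩
      y * (q * b + l * v)          ≡⟨ scale b l v ⟩
      b + (l * y) * v              ∎
      where
      open ≡-Reasoning
      scale : ∀ a k u → y * (q * a + k * u) ≡ a + (k * y) * u
      scale a k u = begin
        y * (q * a + k * u)         ≡⟨ solve 5 (λ y q a k u → y :* (q :* a :+ k :* u) := (q :* y) :* a :+ (k :* y) :* u)
                                             refl y q a k u ⟩
        (q * y) * a + (k * y) * u   ≡⟨ cong (λ z → z * a + (k * y) * u) qy≡1 ⟩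
        1# * a + (k * y) * u        ≡⟨ cong (_+ (k * y) * u) (*-identityˡ a) ⟩
        a + (k * y) * u             ∎

    inverse-complement : ∀ {k r} → q ≡ k + r → 1# - (k * y) ≡ r * y
    inverse-complement {k} {r} refl = begin
      1# - (k * y)              ≡⟨ cong (_- (k * y)) qy≡1 ⟨
      ((k + r) * y) - (k * y)   ≡⟨ solve 3 (λ k r y → (k :+ r) :* y :- k :* y := r :* y) refl k r y ⟩
      r * y                     ∎
      where open ≡-Reasoning

  0<1-t⇒t<1 : ∀ {t} → 0# < 1# - t → t < 1#
  0<1-t⇒t<1 {t} 0<1-t =
    subst₂ _<_ (+-identityˡ t) (solve 2 (λ one t → (one :- t) :+ t := one) refl 1# t) (+-mono-< 0# (1# - t) t 0<1-t)

  +-nonneg : ∀ {x y} → 0# ≤ x → 0# ≤ y → 0# ≤ x + y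
  +-nonneg (inj₁ 0<x) (inj₁ 0<y) = inj₁ (+-pos 0<x 0<y)
  +-nonneg {x} (inj₁ 0<x) (inj₂ refl) = inj₁ (subst (0# <_) (sym (+-identityʳ x)) 0<x)
  +-nonneg {y = y} (inj₂ refl) (inj₁ 0<y) = inj₁ (subst (0# <_) (sym (+-identityˡ y)) 0<y)
  +-nonneg (inj₂ refl) (inj₂ refl) = inj₂ (sym (+-identityʳ 0#))

module PlaneGeometry (R : RealField) where
  open RealField R
  open RealFieldProperties R
  open Geometry R

  private
    det′ : ∀ {m} → (_ _ _ _ _ _ : Polynomial m) → Polynomial m
    det′ px py qx qy rx ry = ((qx :- px) :* (ry :- py)) :- ((qy :- py) :* (rx :- px))

  det-cyclic : ∀ A B C → det B C A ≡ det A B C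
  det-cyclic (a₁ , a₂) (b₁ , b₂) (c₁ , c₂) =
    solve 6 (λ a₁ a₂ b₁ b₂ c₁ c₂ → det′ b₁ b₂ c₁ c₂ a₁ a₂ := det′ a₁ a₂ b₁ b₂ c₁ c₂) refl a₁ a₂ b₁ b₂ c₁ c₂

  det-swap : ∀ A B C → det A C B ≡ - det A B C
  det-swap (a₁ , a₂) (b₁ , b₂) (c₁ , c₂) =
    solve 6 (λ a₁ a₂ b₁ b₂ c₁ c₂ → det′ a₁ a₂ c₁ c₂ b₁ b₂ := :- det′ a₁ a₂ b₁ b₂ c₁ c₂) refl a₁ a₂ b₁ b₂ c₁ c₂

  det-pos-asym : ∀ {A B C} → 0# < det A B C → ¬ 0# < det A C B
  det-pos-asym {A} {B} {C} 0<ABC 0<ACB = <-asym 0<ABC (-pos⇒neg (subst (0# <_) (det-swap A B C) 0<ACB))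

  det-neg-swap : ∀ {A B C} → det A B C < 0# → 0# < det A C B
  det-neg-swap {A} {B} {C} ABC<0 = subst (0# <_) (sym (det-swap A B C)) (neg⇒-pos ABC<0)

  onSegment-start : ∀ A B → OnSegment A B A
  onSegment-start (a₁ , a₂) (b₁ , b₂) = 0# , inj₂ refl , inj₁ 0<1 , cong₂ _,_ (stay a₁ b₁) (stay a₂ b₂)
    where
    stay : ∀ a b → a ≡ a + 0# * (b - a)
    stay a b = sym (trans (cong (a +_) (zeroˡ (b - a))) (+-identityʳ a))

  onSegment-end : ∀ A B → OnSegment A B B
  onSegment-end (a₁ , a₂) (b₁ , b₂) = 1# , inj₁ 0<1 , inj₂ refl , cong₂ _,_ (arrive a₁ b₁) (arrive a₂ b₂)
    where
    arrive : ∀ a b → b ≡ a + 1# * (b - a)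
    arrive a b = sym (trans (cong (a +_) (*-identityˡ (b - a))) (solve 2 (λ a b → a :+ (b :- a) := b) refl a b))

  onSegment-sym : ∀ A B {X} → OnSegment A B X → OnSegment B A X
  onSegment-sym (a₁ , a₂) (b₁ , b₂) (t , 0≤t , t≤1 , refl) =
    1# - t , complement-nonneg t≤1 , complement-≤1 0≤t , cong₂ _,_ (reverse a₁ b₁) (reverse a₂ b₂)
    where
    reverse : ∀ a b → a + t * (b - a) ≡ b + (1# - t) * (a - b)
    reverse a b = begin
      a + t * (b - a)                  ≡⟨ cong (_+ t * (b - a)) (solve 2 (λ a b → a := b :+ (a :- b)) refl a b) ⟩
      (b + (a - b)) + t * (b - a)      ≡⟨ cong (λ u → (b + u) + t * (b - a)) (*-identityˡ (a - b)) ⟨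
      (b + 1# * (a - b)) + t * (b - a) ≡⟨ solve 4 (λ one t a b → (b :+ one :* (a :- b)) :+ t :* (b :- a)
                                                    := b :+ (one :- t) :* (a :- b)) refl 1# t a b ⟩
      b + (1# - t) * (a - b)           ∎
      where open ≡-Reasoning
    complement-nonneg : t ≤ 1# → 0# ≤ 1# - t
    complement-nonneg (inj₁ t<1) = inj₁ (subst (_< 1# - t) (-‿inverseʳ t) (+-mono-< t 1# (- t) t<1))
    complement-nonneg (inj₂ refl) = inj₂ (sym (-‿inverseʳ 1#))
    complement-≤1 : 0# ≤ t → 1# - t ≤ 1#
    complement-≤1 (inj₁ 0<t) =
      inj₁ (subst₂ _<_ (+-comm (- t) 1#) (+-identityˡ 1#) (+-mono-< (- t) 0# 1# (pos⇒-neg 0<t)))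
    complement-≤1 (inj₂ refl) = inj₂ (trans (cong (1# +_) -0#≈0#) (+-identityʳ 1#))

  Intersect : Point × Point → Point × Point → Set
  Intersect (A , B) (C , D) = ∃ λ X → OnSegment A B X × OnSegment C D X

  intersect-swapˡ : ∀ {A B S} → Intersect (A , B) S → Intersect (B , A) S
  intersect-swapˡ {A} {B} (X , X∈AB , X∈S) = X , onSegment-sym A B X∈AB , X∈S

  intersect-swapʳ : ∀ {S C D} → Intersect S (C , D) → Intersect S (D , C)
  intersect-swapʳ {C = C} {D} (X , X∈S , X∈CD) = X , X∈S , onSegment-sym C D X∈CD

  intersect-sym : ∀ {S T} → Intersect S T → Intersect T S
  intersect-sym (X , X∈S , X∈T) = X , X∈T , X∈S

  private
    cramer₁ : ∀ A B C X → det B C X * proj₁ A + (det C A X * proj₁ B + det A B X * proj₁ C) ≡ det A B C * proj₁ X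
    cramer₁ (a₁ , a₂) (b₁ , b₂) (c₁ , c₂) (x₁ , x₂) = solve 8 (λ a₁ a₂ b₁ b₂ c₁ c₂ x₁ x₂ →
      det′ b₁ b₂ c₁ c₂ x₁ x₂ :* a₁ :+ (det′ c₁ c₂ a₁ a₂ x₁ x₂ :* b₁ :+ det′ a₁ a₂ b₁ b₂ x₁ x₂ :* c₁)
      := det′ a₁ a₂ b₁ b₂ c₁ c₂ :* x₁) refl a₁ a₂ b₁ b₂ c₁ c₂ x₁ x₂

    cramer₂ : ∀ A B C X → det B C X * proj₂ A + (det C A X * proj₂ B + det A B X * proj₂ C) ≡ det A B C * proj₂ X
    cramer₂ (a₁ , a₂) (b₁ , b₂) (c₁ , c₂) (x₁ , x₂) = solve 8 (λ a₁ a₂ b₁ b₂ c₁ c₂ x₁ x₂ →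
      det′ b₁ b₂ c₁ c₂ x₁ x₂ :* a₂ :+ (det′ c₁ c₂ a₁ a₂ x₁ x₂ :* b₂ :+ det′ a₁ a₂ b₁ b₂ x₁ x₂ :* c₂)
      := det′ a₁ a₂ b₁ b₂ c₁ c₂ :* x₂) refl a₁ a₂ b₁ b₂ c₁ c₂ x₁ x₂

    det-split : ∀ A B C X → det B C X + (det C A X + det A B X) ≡ det A B C
    det-split (a₁ , a₂) (b₁ , b₂) (c₁ , c₂) (x₁ , x₂) = solve 8 (λ a₁ a₂ b₁ b₂ c₁ c₂ x₁ x₂ →
      det′ b₁ b₂ c₁ c₂ x₁ x₂ :+ (det′ c₁ c₂ a₁ a₂ x₁ x₂ :+ det′ a₁ a₂ b₁ b₂ x₁ x₂)
      := det′ a₁ a₂ b₁ b₂ c₁ c₂) refl a₁ a₂ b₁ b₂ c₁ c₂ x₁ x₂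

    det-exchange : ∀ A B C D → det A B C + det A C D ≡ det A B D + det B C D
    det-exchange (a₁ , a₂) (b₁ , b₂) (c₁ , c₂) (d₁ , d₂) = solve 8 (λ a₁ a₂ b₁ b₂ c₁ c₂ d₁ d₂ →
      det′ a₁ a₂ b₁ b₂ c₁ c₂ :+ det′ a₁ a₂ c₁ c₂ d₁ d₂ := det′ a₁ a₂ b₁ b₂ d₁ d₂ :+ det′ b₁ b₂ c₁ c₂ d₁ d₂)
      refl a₁ a₂ b₁ b₂ c₁ c₂ d₁ d₂

    crossing-point₁ : ∀ A B C D →
      (det A B C + det A C D) * proj₁ A + det A B D * (proj₁ C - proj₁ A)
      ≡ (det A B C + det A C D) * proj₁ B + det A B C * (proj₁ D - proj₁ B)
    crossing-point₁ (a₁ , a₂) (b₁ , b₂) (c₁ , c₂) (d₁ , d₂) = solve 8 (λ a₁ a₂ b₁ b₂ c₁ c₂ d₁ d₂ →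
      (det′ a₁ a₂ b₁ b₂ c₁ c₂ :+ det′ a₁ a₂ c₁ c₂ d₁ d₂) :* a₁ :+ det′ a₁ a₂ b₁ b₂ d₁ d₂ :* (c₁ :- a₁)
      := (det′ a₁ a₂ b₁ b₂ c₁ c₂ :+ det′ a₁ a₂ c₁ c₂ d₁ d₂) :* b₁ :+ det′ a₁ a₂ b₁ b₂ c₁ c₂ :* (d₁ :- b₁))
      refl a₁ a₂ b₁ b₂ c₁ c₂ d₁ d₂

    crossing-point₂ : ∀ A B C D →
      (det A B C + det A C D) * proj₂ A + det A B D * (proj₂ C - proj₂ A)
      ≡ (det A B C + det A C D) * proj₂ B + det A B C * (proj₂ D - proj₂ B)
    crossing-point₂ (a₁ , a₂) (b₁ , b₂) (c₁ , c₂) (d₁ , d₂) = solve 8 (λ a₁ a₂ b₁ b₂ c₁ c₂ d₁ d₂ →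
      (det′ a₁ a₂ b₁ b₂ c₁ c₂ :+ det′ a₁ a₂ c₁ c₂ d₁ d₂) :* a₂ :+ det′ a₁ a₂ b₁ b₂ d₁ d₂ :* (c₂ :- a₂)
      := (det′ a₁ a₂ b₁ b₂ c₁ c₂ :+ det′ a₁ a₂ c₁ c₂ d₁ d₂) :* b₂ :+ det′ a₁ a₂ b₁ b₂ c₁ c₂ :* (d₂ :- b₂))
      refl a₁ a₂ b₁ b₂ c₁ c₂ d₁ d₂

  record InTriangle (A B C X : Point) : Set where
    field
      α β γ         : Carrier
      α-pos         : 0# < α
      β-pos         : 0# < β
      γ-pos         : 0# < γ
      weights-sum   : α + (β + γ) ≡ 1#
      x-combination : α * proj₁ A + (β * proj₁ B + γ * proj₁ C) ≡ proj₁ X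
      y-combination : α * proj₂ A + (β * proj₂ B + γ * proj₂ C) ≡ proj₂ X

  -- Cramer's rule: α = [BCX]/[ABC], β = [CAX]/[ABC], γ = [ABX]/[ABC], where [ABC] = det A B C.
  orientations⇒inTriangle : ∀ {A B C X} → 0# < det A B X → 0# < det B C X → 0# < det C A X → InTriangle A B C X
  orientations⇒inTriangle {A} {B} {C} {X} 0<ABX 0<BCX 0<CAX = record
    { α = det B C X * y ; β = det C A X * y ; γ = det A B X * y
    ; α-pos = *-pos _ _ 0<BCX 0<y
    ; β-pos = *-pos _ _ 0<CAX 0<y
    ; γ-pos = *-pos _ _ 0<ABX 0<y
    ; weights-sum   = inverse-sum qy≡1 (det-split A B C X)
    ; x-combination = inverse-combination qy≡1 (cramer₁ A B C X)
    ; y-combination = inverse-combination qy≡1 (cramer₂ A B C X)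
    }
    where
    0<ABC : 0# < det A B C
    0<ABC = subst (0# <_) (det-split A B C X) (+-pos 0<BCX (+-pos 0<CAX 0<ABX))
    y = proj₁ (inverse-pos 0<ABC)
    qy≡1 = proj₁ (proj₂ (inverse-pos 0<ABC))
    0<y = proj₂ (proj₂ (inverse-pos 0<ABC))

  -- The crossing point is A + t (C - A) = B + s (D - B) with t = [ABD]/q, s = [ABC]/q and
  -- q = [ABC] + [ACD] = [ABD] + [BCD], so that 1 - t = [BCD]/q and 1 - s = [ACD]/q.
  crossing : ∀ {A B C D} → 0# < det A B C → 0# < det A B D → 0# < det A C D → 0# < det B C D →
             Intersect (A , C) (B , D)
  crossing {A@(a₁ , a₂)} {B@(b₁ , b₂)} {C@(c₁ , c₂)} {D@(d₁ , d₂)} 0<ABC 0<ABD 0<ACD 0<BCD =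
    (a₁ + t * (c₁ - a₁) , a₂ + t * (c₂ - a₂)) ,
    (t , inj₁ (*-pos _ _ 0<ABD 0<y) , inj₁ (below-1 (det-exchange A B C D) 0<BCD) , refl) ,
    (s , inj₁ (*-pos _ _ 0<ABC 0<y) , inj₁ (below-1 refl 0<ACD) ,
     cong₂ _,_ (inverse-affine qy≡1 (crossing-point₁ A B C D)) (inverse-affine qy≡1 (crossing-point₂ A B C D)))
    where
    q = det A B C + det A C D
    y = proj₁ (inverse-pos (+-pos 0<ABC 0<ACD))
    qy≡1 = proj₁ (proj₂ (inverse-pos (+-pos 0<ABC 0<ACD)))
    0<y = proj₂ (proj₂ (inverse-pos (+-pos 0<ABC 0<ACD)))
    t = det A B D * y
    s = det A B C * y
    below-1 : ∀ {k r} → q ≡ k + r → 0# < r → k * y < 1#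
    below-1 q≡k+r 0<r = 0<1-t⇒t<1 (subst (0# <_) (sym (inverse-complement qy≡1 q≡k+r)) (*-pos _ _ 0<r 0<y))

  indicator : ∀ {n} → Fin n → Fin n → Carrier
  indicator fzero    fzero    = 1#
  indicator fzero    (fsuc _) = 0#
  indicator (fsuc _) fzero    = 0#
  indicator (fsuc i) (fsuc j) = indicator i j

  indicator-≢ : ∀ {n} {i j : Fin n} → i ≢ j → indicator i j ≡ 0#
  indicator-≢ {i = fzero}  {fzero}  i≢j = contradiction refl i≢j
  indicator-≢ {i = fzero}  {fsuc _} _   = refl
  indicator-≢ {i = fsuc _} {fzero}  _   = refl
  indicator-≢ {i = fsuc i} {fsuc j} i≢j = indicator-≢ (i≢j ∘ cong fsuc)

  indicator-nonneg : ∀ {n} (i j : Fin n) {α} → 0# < α → 0# ≤ indicator i j * α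
  indicator-nonneg fzero    fzero    {α} 0<α = inj₁ (subst (0# <_) (sym (*-identityˡ α)) 0<α)
  indicator-nonneg fzero    (fsuc _) {α} _   = inj₂ (sym (zeroˡ α))
  indicator-nonneg (fsuc _) fzero    {α} _   = inj₂ (sym (zeroˡ α))
  indicator-nonneg (fsuc i) (fsuc j)       0<α = indicator-nonneg i j 0<α

  sumF-cong : ∀ {n} {f g : Fin n → Carrier} → (∀ j → f j ≡ g j) → sumF f ≡ sumF g
  sumF-cong {zero}  f≗g = refl
  sumF-cong {suc n} f≗g = cong₂ _+_ (f≗g fzero) (sumF-cong (f≗g ∘ fsuc))

  sumF-+ : ∀ {n} (f g : Fin n → Carrier) → sumF (λ j → f j + g j) ≡ sumF f + sumF g
  sumF-+ {zero}  f g = sym (+-identityʳ 0#)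
  sumF-+ {suc n} f g = trans (cong (f fzero + g fzero +_) (sumF-+ (f ∘ fsuc) (g ∘ fsuc)))
    (solve 4 (λ a b c d → (a :+ b) :+ (c :+ d) := (a :+ c) :+ (b :+ d)) refl
             (f fzero) (g fzero) (sumF (f ∘ fsuc)) (sumF (g ∘ fsuc)))

  sumF-zero : ∀ {n} (h : Fin n → Carrier) → sumF (λ j → 0# * h j) ≡ 0#
  sumF-zero {zero}  h = refl
  sumF-zero {suc n} h = trans (cong₂ _+_ (zeroˡ (h fzero)) (sumF-zero (h ∘ fsuc))) (+-identityʳ 0#)

  sumF-indicator : ∀ {n} (i : Fin n) (h : Fin n → Carrier) → sumF (λ j → indicator i j * h j) ≡ h i
  sumF-indicator fzero    h = trans (cong₂ _+_ (*-identityˡ (h fzero)) (sumF-zero (h ∘ fsuc))) (+-identityʳ (h fzero))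
  sumF-indicator (fsuc i) h =
    trans (cong₂ _+_ (zeroˡ (h fzero)) (sumF-indicator i (h ∘ fsuc))) (+-identityˡ (h (fsuc i)))

  inTriangle⇒inHullWithout : ∀ {n} (p : Fin n → Point) {a b c d} → a ≢ d → b ≢ d → c ≢ d →
                             InTriangle (p a) (p b) (p c) (p d) → InHullWithout p d (p d)
  inTriangle⇒inHullWithout p {a} {b} {c} {d} a≢d b≢d c≢d inside =
    w , w-d≡0 , w-nonneg , w-sum ,
    cong₂ _,_ (sym (trans (weighted (proj₁ ∘ p)) x-combination)) (sym (trans (weighted (proj₂ ∘ p)) y-combination))
    where
    open InTriangle inside
    w : Fin _ → Carrier
    w j = indicator a j * α + (indicator b j * β + indicator c j * γ)

    weighted : ∀ h → sumF (λ j → w j * h j) ≡ α * h a + (β * h b + γ * h c)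
    weighted h = begin
      sumF (λ j → w j * h j)
        ≡⟨ sumF-cong (λ j → solve 7 (λ ia ib ic α β γ x → (ia :* α :+ (ib :* β :+ ic :* γ)) :* x
                                       := ia :* (α :* x) :+ (ib :* (β :* x) :+ ic :* (γ :* x)))
                                refl (indicator a j) (indicator b j) (indicator c j) α β γ (h j)) ⟩
      sumF (λ j → share a α j + (share b β j + share c γ j))
        ≡⟨ trans (sumF-+ (share a α) _) (cong (sumF (share a α) +_) (sumF-+ (share b β) (share c γ))) ⟩
      sumF (share a α) + (sumF (share b β) + sumF (share c γ))
        ≡⟨ cong₂ _+_ (sumF-indicator a _) (cong₂ _+_ (sumF-indicator b _) (sumF-indicator c _)) ⟩
      α * h a + (β * h b + γ * h c) ∎
      where
      open ≡-Reasoning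
      share : Fin _ → Carrier → Fin _ → Carrier
      share i x j = indicator i j * (x * h j)

    w-d≡0 : w d ≡ 0#
    w-d≡0 = trans (cong₂ _+_ (vanish a≢d α) (cong₂ _+_ (vanish b≢d β) (vanish c≢d γ)))
                  (trans (+-identityˡ (0# + 0#)) (+-identityˡ 0#))
      where
      vanish : ∀ {i} → i ≢ d → ∀ x → indicator i d * x ≡ 0#
      vanish i≢d x = trans (cong (_* x) (indicator-≢ i≢d)) (zeroˡ x)

    w-nonneg : ∀ j → 0# ≤ w j
    w-nonneg j = +-nonneg (indicator-nonneg a j α-pos) (+-nonneg (indicator-nonneg b j β-pos) (indicator-nonneg c j γ-pos))

    w-sum : sumF w ≡ 1#
    w-sum = begin
      sumF w                      ≡⟨ sumF-cong (λ j → *-identityʳ (w j)) ⟨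
      sumF (λ j → w j * 1#)       ≡⟨ weighted (λ _ → 1#) ⟩
      α * 1# + (β * 1# + γ * 1#)  ≡⟨ cong₂ _+_ (*-identityʳ α) (cong₂ _+_ (*-identityʳ β) (*-identityʳ γ)) ⟩
      α + (β + γ)                 ≡⟨ weights-sum ⟩
      1#                          ∎
      where open ≡-Reasoning

  ConvexlyOrdered : ∀ {n} → (Fin n → Point) → Set
  ConvexlyOrdered q = ∀ {a b c} → a Fin.< b → b Fin.< c → 0# < det (q a) (q b) (q c)

module AngularOrder (R : RealField) {m} (p : Fin (suc m) → Geometry.Point R)
                   (general : Geometry.GeneralPosition R p) (convex : Geometry.ConvexPosition R p) where
  open RealField R
  open RealFieldProperties R
  open Geometry R
  open PlaneGeometry R

  data _≺_ : Rel (Fin (suc m)) 0ℓ where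
    pivot≺            : ∀ {j} → fzero ≺ fsuc j
    counterclockwise≺ : ∀ {i j} → 0# < det (p fzero) (p (fsuc i)) (p (fsuc j)) → fsuc i ≺ fsuc j

  ≺-asym : ∀ {i j} → i ≺ j → ¬ j ≺ i
  ≺-asym (counterclockwise≺ 0<0ij) (counterclockwise≺ 0<0ji) = det-pos-asym 0<0ij 0<0ji

  ≺-irrefl : ∀ {i} → ¬ i ≺ i
  ≺-irrefl i≺i = ≺-asym i≺i i≺i

  ≺⇒≢ : ∀ {i j} → i ≺ j → i ≢ j
  ≺⇒≢ i≺i refl = ≺-irrefl i≺i

  notInTriangle : ∀ {a b c d} → a ≢ d → b ≢ d → c ≢ d → ¬ InTriangle (p a) (p b) (p c) (p d)
  notInTriangle a≢d b≢d c≢d = convex _ ∘ inTriangle⇒inHullWithout p a≢d b≢d c≢d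

  det-sign : ∀ {i j k} → i ≢ j → j ≢ k → i ≢ k → 0# < det (p i) (p j) (p k) ⊎ 0# < det (p i) (p k) (p j)
  det-sign {i} {j} {k} i≢j j≢k i≢k with nonzero-sign (general i j k i≢j j≢k i≢k)
  ... | inj₁ 0<ijk = inj₁ 0<ijk
  ... | inj₂ ijk<0 = inj₂ (det-neg-swap ijk<0)

  ≺-trans : ∀ {i j k} → i ≺ j → j ≺ k → i ≺ k
  ≺-trans pivot≺ (counterclockwise≺ _) = pivot≺
  ≺-trans {fsuc i} {_} {fsuc k} i≺j@(counterclockwise≺ 0<0ij) j≺k@(counterclockwise≺ 0<0jk)
    with det-sign {fzero} {fsuc i} {fsuc k} (λ ()) (λ { refl → ≺-asym i≺j j≺k }) (λ ())
  ... | inj₁ 0<0ik = counterclockwise≺ 0<0ik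
  ... | inj₂ 0<0ki = contradiction
    (orientations⇒inTriangle (subst (0# <_) (sym (det-cyclic _ _ _)) 0<0ij)
                             (subst (0# <_) (sym (det-cyclic _ _ _)) 0<0jk)
                             (subst (0# <_) (sym (det-cyclic _ _ _)) 0<0ki))
    (notInTriangle (λ ()) (λ ()) (λ ()))

  ≺-compare : Trichotomous _≡_ _≺_
  ≺-compare fzero    fzero    = tri≈ (λ ()) refl (λ ())
  ≺-compare fzero    (fsuc j) = tri< pivot≺ (λ ()) (λ ())
  ≺-compare (fsuc i) fzero    = tri> (λ ()) (λ ()) pivot≺
  ≺-compare i@(fsuc _) j@(fsuc _) with i Finₚ.≟ j
  ... | yes refl = tri≈ ≺-irrefl refl ≺-irrefl
  ... | no i≢j with det-sign {fzero} {i} {j} (λ ()) i≢j (λ ())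
  ...   | inj₁ 0<0ij = tri< (counterclockwise≺ 0<0ij) i≢j (≺-asym (counterclockwise≺ 0<0ij))
  ...   | inj₂ 0<0ji = tri> (≺-asym (counterclockwise≺ 0<0ji)) i≢j (counterclockwise≺ 0<0ji)

  ≺-isStrictTotalOrder : IsStrictTotalOrder _≡_ _≺_
  ≺-isStrictTotalOrder = record
    { isStrictPartialOrder = record
      { isEquivalence = isEquivalence
      ; irrefl        = λ { refl → ≺-irrefl }
      ; trans         = ≺-trans
      ; <-resp-≈      = resp₂ _≺_
      }
    ; compare = ≺-compare }

  ≺-orientation : ∀ {i j k} → i ≺ j → j ≺ k → 0# < det (p i) (p j) (p k)
  ≺-orientation pivot≺ (counterclockwise≺ 0<0jk) = 0<0jk
  ≺-orientation i≺j@(counterclockwise≺ 0<0ij) j≺k@(counterclockwise≺ 0<0jk)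
    with det-sign (≺⇒≢ i≺j) (≺⇒≢ j≺k) (≺⇒≢ (≺-trans i≺j j≺k))
  ... | inj₁ 0<ijk = 0<ijk
  ... | inj₂ 0<ikj = contradiction
    (orientations⇒inTriangle 0<0ij 0<ikj (subst (0# <_) (sym (trans (det-cyclic _ _ _) (det-cyclic _ _ _))) 0<0jk))
    (notInTriangle (λ ()) (≺⇒≢ i≺j) (≺⇒≢ j≺k ∘ sym))

  open Ranking ≺-isStrictTotalOrder using (ranking; ranking⁻¹-mono)

  convexOrdering : ∃ λ (σ : Permutation′ (suc m)) → ConvexlyOrdered (p ∘ (σ ⟨$⟩ˡ_))
  convexOrdering = ranking , λ a<b b<c → ≺-orientation (ranking⁻¹-mono a<b) (ranking⁻¹-mono b<c)

module DisjointnessGraph (R : RealField) where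
  open RealField R
  open Geometry R
  open PlaneGeometry R

  segment : ∀ {n} → (Fin n → Point) → Code n → Point × Point
  segment q (a , b) = q a , q b

  sharesEndpoint⇒intersect : ∀ {n} (q : Fin n → Point) {u v} → SharesEndpoint u v →
                             Intersect (segment q u) (segment q v)
  sharesEndpoint⇒intersect q {a , b} (inj₁ refl)               = q a , onSegment-start _ _ , onSegment-start _ _
  sharesEndpoint⇒intersect q {a , b} (inj₂ (inj₁ refl))        = q a , onSegment-start _ _ , onSegment-end _ _
  sharesEndpoint⇒intersect q {a , b} (inj₂ (inj₂ (inj₁ refl))) = q b , onSegment-end _ _ , onSegment-start _ _
  sharesEndpoint⇒intersect q {a , b} (inj₂ (inj₂ (inj₂ refl))) = q b , onSegment-end _ _ , onSegment-end _ _

  interleaved⇒intersect : ∀ {n} {q : Fin n → Point} → ConvexlyOrdered q → ∀ {u v} → Interleaved u v →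
                          Intersect (segment q u) (segment q v)
  interleaved⇒intersect ordered (inj₁ (a<c , c<b , b<d)) =
    crossing (ordered a<c c<b) (ordered a<c (Finₚ.<-trans c<b b<d))
             (ordered (Finₚ.<-trans a<c c<b) b<d) (ordered c<b b<d)
  interleaved⇒intersect ordered (inj₂ (c<a , a<d , d<b)) = intersect-sym
    (crossing (ordered c<a a<d) (ordered c<a (Finₚ.<-trans a<d d<b))
              (ordered (Finₚ.<-trans c<a a<d) d<b) (ordered a<d d<b))

  sortPair-intersectˡ : ∀ {n} (q : Fin n → Point) a b {T} →
                        Intersect (segment q (sortPair a b)) T → Intersect (q a , q b) T
  sortPair-intersectˡ q a b with sortPair a b | sortPair-cases a b
  ... | _ | inj₁ refl = id
  ... | _ | inj₂ refl = intersect-swapˡ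

  sortPair-intersectʳ : ∀ {n} (q : Fin n → Point) a b {S} →
                        Intersect S (segment q (sortPair a b)) → Intersect S (q a , q b)
  sortPair-intersectʳ q a b with sortPair a b | sortPair-cases a b
  ... | _ | inj₁ refl = id
  ... | _ | inj₂ refl = intersect-swapʳ

  code-intersect : ∀ {n} (p : Fin n → Point) (σ : Permutation′ n) {s t} →
                   Intersect (segment (p ∘ (σ ⟨$⟩ˡ_)) (code σ s)) (segment (p ∘ (σ ⟨$⟩ˡ_)) (code σ t)) →
                   Intersect (segPts p s) (segPts p t)
  code-intersect p σ {(i , j) , _} {(k , l) , _} =
    subst₂ Intersect (cong₂ _,_ (relabel i) (relabel j)) (cong₂ _,_ (relabel k) (relabel l))
    ∘ sortPair-intersectʳ q (σ ⟨$⟩ʳ k) (σ ⟨$⟩ʳ l) ∘ sortPair-intersectˡ q (σ ⟨$⟩ʳ i) (σ ⟨$⟩ʳ j)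
    where
    q = p ∘ (σ ⟨$⟩ˡ_)
    relabel : ∀ i → q (σ ⟨$⟩ʳ i) ≡ p i
    relabel i = cong p (inverseˡ σ)

  module _ {n} (p : Fin n → Point) (σ : Permutation′ n) {Meets : Rel (Code n) 0ℓ} (meets? : Decidable Meets)
           (meets⇒intersect : ∀ {u v} → Meets u v →
                              Intersect (segment (p ∘ (σ ⟨$⟩ˡ_)) u) (segment (p ∘ (σ ⟨$⟩ˡ_)) v)) where
    open HamiltonianCycleSearch (≡-dec Finₚ._≟_ Finₚ._≟_) (λ u v → ¬? (meets? u v))

    nonHamiltonian : hasCycleAvoiding {n} {Meets} meets? (increasingPairs n) ≡ false →
                     ¬ Hamiltonian (Segment n) (DisjointSeg p)
    nonHamiltonian noCycle ham = subst T noCycle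
      (hamiltonian⇒hasHamiltonianCycle (code σ) (code-injective σ)
        (λ {s} {t} disjoint → disjoint ∘ code-intersect p σ {s} {t} ∘ meets⇒intersect)
        (increasingPairs-unique n) (code-image σ) ham)

open import Data.Nat using (_≤_)

lemma2 : (R : RealField) (n : ℕ) → 2 ≤ n →
         (p : Fin n → Geometry.Point R) → Injective _≡_ _≡_ p →
         Geometry.GeneralPosition R p →
         (n ≤ 5 ⊎ (n ≡ 6 × Geometry.ConvexPosition R p)) →
         ¬ Hamiltonian (Geometry.Segment R n) (Geometry.DisjointSeg R p)
lemma2 R n _ p _ _ (inj₁ n≤5) =
  nonHamiltonian p Permutation.id sharesEndpoint? (sharesEndpoint⇒intersect p) (kneser-nonHamiltonian n≤5)
  where open DisjointnessGraph R
lemma2 R 6 _ p _ general (inj₂ (refl , convex)) =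
  nonHamiltonian p σ sharesEndpointOrInterleaved?
    [ sharesEndpoint⇒intersect _ , interleaved⇒intersect ordered ] hexagonChords-nonHamiltonian
  where
  open DisjointnessGraph R
  σ = proj₁ (AngularOrder.convexOrdering R p general convex)
  ordered = proj₂ (AngularOrder.convexOrdering R p general convex)
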